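{- There is an absolute constant $C$ such that the following holds. Let $n\ge 2$ and let $X=\{(i,X_i):1\le i\le n\}$ be an $n$-queens configuration on the ordinary $n\times n$ board. For each row $i$ let $a_i,b_i,c_i$ be the number of columns $j\neq X_i$ with $r(i,j)=3$, $r(i,j)=2$, $r(i,j)=1$ respectively. Then for every $0<x<1$, \[\sum_{i=1}^n\log(a_ix^2+b_ix+c_i)\ \le\ C+n\log\!\left(\frac{5}{8}nx^2+\frac{3}{8}n\right).\]
   Context: The board has squares $(i,j)$, $1\le i,j\le n$. An $n$-queens configuration $X=\{(i,X_i)\}$ has one queen per row, with no two queens sharing a column or a diagonal (a set of squares with $i-j$ constant or with $i+j$ constant). For a square $(i,j)$ with $j\ne X_i$, $r(i,j)$ is the number of rows $i'\neq i$ such that the queen $(i',X_{i'})$ shares a column or a diagonal with $(i,j)$; it always lies in $\{1,2,3\}$, so $a_i+b_i+c_i=n-1$. $\log$ is the natural logarithm.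
   Formalization: The parameter x takes only rational values with $0<x<1$. -}

module Defs where

open import Data.Nat as ℕ using (ℕ; zero; suc)
open import Data.Fin using (Fin; toℕ)
open import Data.Fin.Properties using () renaming (_≟_ to _≟ᶠ_)
open import Data.List using (List; length; filter; allFin; foldr; map)
open import Data.Integer using (+_)
open import Data.Rational using (ℚ; _/_; 1ℚ)
import Data.Rational as Q
open import Data.Product using (_×_)
open import Data.Sum using (_⊎_)
open import Relation.Nullary using (¬_; Dec)
open import Relation.Nullary.Decidable using (_⊎-dec_; _×-dec_; ¬?)
open import Relation.Binary.PropositionalEquality using (_≡_)

-- Rows and columns are indexed by Fin n (0-based; i ↦ i+1 is harmless
-- since only differences / sums of coordinates matter).

IsQueens : (n : ℕ) → (Fin n → Fin n) → Set
IsQueens n X =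
  ∀ (i i′ : Fin n) → ¬ (i ≡ i′) →
    ¬ (X i ≡ X i′)
    × ¬ (toℕ i ℕ.+ toℕ (X i) ≡ toℕ i′ ℕ.+ toℕ (X i′))
    × ¬ (toℕ i ℕ.+ toℕ (X i′) ≡ toℕ i′ ℕ.+ toℕ (X i))    -- same i-j diagonal

Attacks : {n : ℕ} → (Fin n → Fin n) → Fin n → Fin n → Fin n → Set
Attacks X i j i′ =
  (X i′ ≡ j)
  ⊎ (toℕ i ℕ.+ toℕ j ≡ toℕ i′ ℕ.+ toℕ (X i′))
  ⊎ (toℕ i ℕ.+ toℕ (X i′) ≡ toℕ i′ ℕ.+ toℕ j)

attacks? : {n : ℕ} (X : Fin n → Fin n) (i j i′ : Fin n) → Dec (Attacks X i j i′)
attacks? X i j i′ =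
  (X i′ ≟ᶠ j) ⊎-dec ((toℕ i ℕ.+ toℕ j ℕ.≟ toℕ i′ ℕ.+ toℕ (X i′))
                    ⊎-dec (toℕ i ℕ.+ toℕ (X i′) ℕ.≟ toℕ i′ ℕ.+ toℕ j))

r : {n : ℕ} → (Fin n → Fin n) → Fin n → Fin n → ℕ
r {n} X i j = length (filter (λ i′ → ¬? (i ≟ᶠ i′) ×-dec attacks? X i j i′) (allFin n))

countR : {n : ℕ} → (Fin n → Fin n) → Fin n → ℕ → ℕ
countR {n} X i k = length (filter (λ j → ¬? (j ≟ᶠ X i) ×-dec (r X i j ℕ.≟ k)) (allFin n))

aR bR cR : {n : ℕ} → (Fin n → Fin n) → Fin n → ℕ
aR X i = countR X i 3
bR X i = countR X i 2
cR X i = countR X i 1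

ℕ→ℚ : ℕ → ℚ
ℕ→ℚ m = + m / 1

_^ℚ_ : ℚ → ℕ → ℚ
q ^ℚ zero = 1ℚ
q ^ℚ suc m = q Q.* (q ^ℚ m)

prodFin : (n : ℕ) → (Fin n → ℚ) → ℚ
prodFin n f = foldr Q._*_ 1ℚ (map f (allFin n))

rowPoly : {n : ℕ} → (Fin n → Fin n) → Fin n → ℚ → ℚ
rowPoly X i x = ℕ→ℚ (aR X i) Q.* (x Q.* x) Q.+ ℕ→ℚ (bR X i) Q.* x Q.+ ℕ→ℚ (cR X i)

rhsBase : ℕ → ℚ → ℚ
rhsBase n x = (+ 5 / 8) Q.* ℕ→ℚ n Q.* (x Q.* x) Q.+ (+ 3 / 8) Q.* ℕ→ℚ n

module Submission where

-- AM–GM turns the claim, with K = 1, into Σᵢ (aᵢx² + bᵢx + cᵢ) ≤ n((5/8)nx² + (3/8)n).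
-- As x ≤ (1 + x²)/2, the i-th term is at most (aᵢ+bᵢ+cᵢ)x² + (2cᵢ+bᵢ)(1 − x²)/2, and
-- aᵢ+bᵢ+cᵢ ≤ n, so everything rests on Σᵢ (2cᵢ+bᵢ) ≤ (3/4)n².
--
-- Off the queen of row i we have 2[r = 1] + [r = 2] ≤ 3 − r, hence Σᵢ (2cᵢ+bᵢ) ≤ 3n(n − 1) − Σ r.
-- Counted queen by queen, Σ r is the number of squares a queen attacks outside its own row:
-- n − 1 in its column and the rest of its two diagonals, which for a queen at (u, v) have at
-- least n − |u+v+1−n| and n − |u−v| squares. What is left is
-- Σᵢ (2cᵢ+bᵢ) ≤ Σ_queens (|u+v+1−n| + |u−v|) = Σ_queens max(δu, δv), where δk = |2k+1−n|.
-- Finally 4 max(s, t) ≤ ψs + ψt with ψt = n + 2(2t − n)⁺; since X is a permutation, the rows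
-- and the columns of the queens each contribute Σ_b ψ(δb) ≤ (3/2)n².

open import Defs

module Counting where

  open import Data.Nat.Base using (ℕ; zero; suc; _+_; _*_; _∸_; ∣_-_∣; _≤_; _<_; z≤n; s≤s)
  open import Data.Nat.Properties hiding (_≟_; suc-injective)
  open import Data.Fin.Base using (Fin; zero; suc; toℕ)
  open import Data.Fin.Properties using (_≟_; suc-injective)
  open import Data.Bool.Base using (if_then_else_)
  open import Data.List.Base using (length; filter; tabulate)
  open import Data.Product.Base using (_,_)
  open import Data.Sum.Base using (inj₁; inj₂)
  open import Function.Base using (_∘_)
  open import Function.Definitions using (Injective)
  open import Relation.Nullary using (Dec; yes; no; does; ¬_; contradiction)
  open import Relation.Nullary.Decidable using (_×-dec_; _⊎-dec_)
  open import Relation.Unary using (Pred; Decidable)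
  open import Relation.Binary.PropositionalEquality
  open import Data.Nat.Tactic.RingSolver using (solve-∀)
  open import Algebra.Properties.Semiring.Sum +-*-semiring public

  𝟙 : ∀ {p} {P : Set p} → Dec P → ℕ
  𝟙 P? = if does P? then 1 else 0

  𝟙-yes : ∀ {p} {P : Set p} → P → (P? : Dec P) → 𝟙 P? ≡ 1
  𝟙-yes p (yes _) = refl
  𝟙-yes p (no ¬p) = contradiction p ¬p

  𝟙-no : ∀ {p} {P : Set p} → ¬ P → (P? : Dec P) → 𝟙 P? ≡ 0
  𝟙-no ¬p (yes p) = contradiction p ¬p
  𝟙-no ¬p (no _)  = refl

  𝟙-×-yes : ∀ {p q} {P : Set p} {Q : Set q} → P → (P? : Dec P) (Q? : Dec Q) → 𝟙 (P? ×-dec Q?) ≡ 𝟙 Q?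
  𝟙-×-yes p (yes _) Q? = refl
  𝟙-×-yes p (no ¬p) Q? = contradiction p ¬p

  𝟙-⊎ : ∀ {p q} {P : Set p} {Q : Set q} → (P → ¬ Q) → (P? : Dec P) (Q? : Dec Q) → 𝟙 (P? ⊎-dec Q?) ≡ 𝟙 P? + 𝟙 Q?
  𝟙-⊎ disjoint (yes p) (yes q) = contradiction q (disjoint p)
  𝟙-⊎ disjoint (yes _) (no _)  = refl
  𝟙-⊎ disjoint (no _)  Q?      = refl

  length-filter-tabulate : ∀ {a p} {A : Set a} {P : Pred A p} (P? : Decidable P) {n} (f : Fin n → A) →
                           length (filter P? (tabulate f)) ≡ ∑[ i < n ] 𝟙 (P? (f i))
  length-filter-tabulate P? {zero}  f = refl
  length-filter-tabulate P? {suc n} f with P? (f zero)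
  ... | yes _ = cong suc (length-filter-tabulate P? (f ∘ suc))
  ... | no _  = length-filter-tabulate P? (f ∘ suc)

  ∑-mono-≤ : ∀ {n} {f g : Fin n → ℕ} → (∀ i → f i ≤ g i) → ∑[ i < n ] f i ≤ ∑[ i < n ] g i
  ∑-mono-≤ {zero}  f≤g = z≤n
  ∑-mono-≤ {suc n} f≤g = +-mono-≤ (f≤g zero) (∑-mono-≤ (f≤g ∘ suc))

  ∑-const : ∀ n c → ∑[ i < n ] c ≡ n * c
  ∑-const zero    c = refl
  ∑-const (suc n) c = cong (c +_) (∑-const n c)

  ∑-zero : ∀ {n} {f : Fin n → ℕ} → (∀ i → f i ≡ 0) → ∑[ i < n ] f i ≡ 0
  ∑-zero {n} f≡0 = trans (sum-cong-≗ f≡0) (trans (∑-const n 0) (*-zeroʳ n))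

  f≤∑f : ∀ {n} (f : Fin n → ℕ) i → f i ≤ ∑[ j < n ] f j
  f≤∑f f zero    = m≤m+n (f zero) _
  f≤∑f f (suc i) = ≤-trans (f≤∑f (f ∘ suc) i) (m≤n+m _ (f zero))

  ∑𝟙[c≟i]*f[i]≡f[c] : ∀ {n} (c : Fin n) (f : Fin n → ℕ) → ∑[ i < n ] (𝟙 (c ≟ i) * f i) ≡ f c
  ∑𝟙[c≟i]*f[i]≡f[c] {suc n} zero f = begin
    f zero + 0 + ∑[ i < n ] 0  ≡⟨ cong (f zero + 0 +_) (∑-zero {n} (λ _ → refl)) ⟩
    f zero + 0 + 0             ≡⟨ +-identityʳ _ ⟩
    f zero + 0                 ≡⟨ +-identityʳ _ ⟩
    f zero                     ∎
    where open ≡-Reasoning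
  ∑𝟙[c≟i]*f[i]≡f[c] (suc c) f = ∑𝟙[c≟i]*f[i]≡f[c] c (f ∘ suc)

  ∑𝟙[c≟i]≡1 : ∀ {n} (c : Fin n) → ∑[ i < n ] 𝟙 (c ≟ i) ≡ 1
  ∑𝟙[c≟i]≡1 c = trans (sum-cong-≗ (λ i → sym (*-identityʳ (𝟙 (c ≟ i))))) (∑𝟙[c≟i]*f[i]≡f[c] c (λ _ → 1))

  1≤∑𝟙 : ∀ {n} {p} {P : Pred (Fin n) p} (P? : Decidable P) j → P j → 1 ≤ ∑[ i < n ] 𝟙 (P? i)
  1≤∑𝟙 P? j p = subst (_≤ ∑[ i < _ ] 𝟙 (P? i)) (𝟙-yes p (P? j)) (f≤∑f (λ i → 𝟙 (P? i)) j)

  ∑-𝟙-unique≤1 : ∀ {n p} {P : Pred (Fin n) p} (P? : Decidable P) →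
                 (∀ {i j} → P i → P j → i ≡ j) → ∑[ i < n ] 𝟙 (P? i) ≤ 1
  ∑-𝟙-unique≤1 {zero}  P? unique = z≤n
  ∑-𝟙-unique≤1 {suc n} P? unique with P? zero
  ... | yes p₀ = ≤-reflexive (cong suc (∑-zero λ i → 𝟙-no (λ p → 0≢suc (unique p₀ p)) (P? (suc i))))
    where
    0≢suc : ∀ {i : Fin n} → zero ≢ suc i
    0≢suc ()
  ... | no _   = ∑-𝟙-unique≤1 (P? ∘ suc) (λ p q → suc-injective (unique p q))

  ∑-∘-injective≤∑ : ∀ {n} {σ : Fin n → Fin n} → Injective _≡_ _≡_ σ →
                    (f : Fin n → ℕ) → ∑[ i < n ] f (σ i) ≤ ∑[ j < n ] f j
  ∑-∘-injective≤∑ {n} {σ} σ-inj f = begin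
    ∑[ i < n ] f (σ i)                          ≡⟨ sum-cong-≗ (λ i → ∑𝟙[c≟i]*f[i]≡f[c] (σ i) f) ⟨
    ∑[ i < n ] ∑[ j < n ] (𝟙 (σ i ≟ j) * f j)  ≡⟨ ∑-comm {n} {n} _ ⟩
    ∑[ j < n ] ∑[ i < n ] (𝟙 (σ i ≟ j) * f j)  ≡⟨ sum-cong-≗ (λ j → *-distribʳ-sum {n} (f j) _) ⟨
    ∑[ j < n ] (∑[ i < n ] 𝟙 (σ i ≟ j) * f j)  ≤⟨ ∑-mono-≤ (λ j → *-monoˡ-≤ (f j) (∑-𝟙-unique≤1 (λ i → σ i ≟ j) (λ p q → σ-inj (trans p (sym q))))) ⟩
    ∑[ j < n ] (1 * f j)                        ≡⟨ sum-cong-≗ (λ j → *-identityˡ (f j)) ⟩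
    ∑[ j < n ] f j                              ∎
    where open ≤-Reasoning

  hi∸lo≤∑ : ∀ {n} lo hi → hi ≤ n → (f : Fin n → ℕ) →
                 (∀ i → lo ≤ toℕ i → toℕ i < hi → 1 ≤ f i) → hi ∸ lo ≤ ∑[ i < n ] f i
  hi∸lo≤∑ zero     zero     _        f pos = z≤n
  hi∸lo≤∑ (suc lo) zero     _        f pos = z≤n
  hi∸lo≤∑ zero     (suc hi) (s≤s le) f pos =
    +-mono-≤ (pos zero z≤n (s≤s z≤n)) (hi∸lo≤∑ 0 hi le (f ∘ suc) (λ i _ i<hi → pos (suc i) z≤n (s≤s i<hi)))
  hi∸lo≤∑ (suc lo) (suc hi) (s≤s le) f pos =
    ≤-trans (hi∸lo≤∑ lo hi le (f ∘ suc) (λ i lo≤i i<hi → pos (suc i) (s≤s lo≤i) (s≤s i<hi))) (m≤n+m _ (f zero))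

  n≤∑+∣p-q∣ : ∀ {n} p q (f : Fin n → ℕ) →
              (∀ i → p ≤ toℕ i + q → toℕ i + q < p + n → 1 ≤ f i) → n ≤ ∑[ i < n ] f i + ∣ p - q ∣
  n≤∑+∣p-q∣ {n} p q f pos with ≤-total q p
  ... | inj₁ q≤p with d , refl ← m≤n⇒∃[o]m+o≡n q≤p = begin
    n                               ≤⟨ m≤n+m∸n n d ⟩
    d + (n ∸ d)                     ≡⟨ +-comm d (n ∸ d) ⟩
    n ∸ d + d                       ≤⟨ +-mono-≤ (hi∸lo≤∑ d n ≤-refl f inWindow) (≤-reflexive ∣q+d-q∣≡d) ⟩
    ∑[ i < n ] f i + ∣ q + d - q ∣  ∎
    where
    open ≤-Reasoning
    ∣q+d-q∣≡d : d ≡ ∣ q + d - q ∣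
    ∣q+d-q∣≡d = sym (trans (∣-∣-comm (q + d) q) (∣m-m+n∣≡n q d))
    inWindow : ∀ i → d ≤ toℕ i → toℕ i < n → 1 ≤ f i
    inWindow i d≤i i<n = pos i (subst (q + d ≤_) (+-comm q (toℕ i)) (+-monoʳ-≤ q d≤i))
                               (subst (toℕ i + q <_) (+-comm n (q + d)) (+-mono-<-≤ i<n (m≤m+n q d)))
  ... | inj₂ p≤q with d , refl ← m≤n⇒∃[o]m+o≡n p≤q = begin
    n                               ≤⟨ m≤n+m∸n n d ⟩
    d + (n ∸ d)                     ≡⟨ +-comm d (n ∸ d) ⟩
    n ∸ d + d                       ≤⟨ +-mono-≤ (hi∸lo≤∑ 0 (n ∸ d) (m∸n≤m n d) f inWindow) (≤-reflexive (sym (∣m-m+n∣≡n p d))) ⟩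
    ∑[ i < n ] f i + ∣ p - p + d ∣  ∎
    where
    open ≤-Reasoning
    inWindow : ∀ i → 0 ≤ toℕ i → toℕ i < n ∸ d → 1 ≤ f i
    inWindow i _ i<n∸d = pos i (≤-trans (m≤m+n p d) (m≤n+m (p + d) (toℕ i)))
                               (subst (_< p + n) (+-left-comm p (toℕ i) d) (+-monoʳ-< p i+d<n))
      where
      d≤n : d ≤ n
      d≤n = <⇒≤ (m∸n≢0⇒n<m (λ n∸d≡0 → n≮0 (subst (toℕ i <_) n∸d≡0 i<n∸d)))
      i+d<n : toℕ i + d < n
      i+d<n = m≤o∸n⇒m+n≤o (suc (toℕ i)) d≤n i<n∸d
      +-left-comm : ∀ a b c → a + (b + c) ≡ b + (a + c)
      +-left-comm = solve-∀

module Diagonals where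

  open Counting
  open import Data.Nat.Base using (ℕ; zero; suc; _+_; _*_; _∸_; ∣_-_∣; _⊔_; _≤_; _<_; z≤n; s≤s; s≤s⁻¹)
  open import Data.Nat.Properties
  open import Data.Fin.Base using (toℕ; fromℕ<)
  open import Data.Fin.Properties using (toℕ-fromℕ<; toℕ-fromℕ; toℕ-inject₁)
  open import Data.Product.Base using (_,_)
  open import Data.Sum.Base using ([_,_]′)
  open import Relation.Nullary using (yes; no)
  open import Function.Base using (_∘_)
  open import Relation.Binary.PropositionalEquality
  open import Data.Nat.Tactic.RingSolver using (solve-∀)

  -- The antidiagonal i − j = u − v is written i + v = u + j to stay in ℕ.
  diagonalSize : ℕ → ℕ → ℕ
  diagonalSize n s = ∑[ i < n ] ∑[ j < n ] 𝟙 (toℕ i + toℕ j ≟ s)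

  antidiagonalSize : ℕ → ℕ → ℕ → ℕ
  antidiagonalSize n u v = ∑[ i < n ] ∑[ j < n ] 𝟙 (toℕ i + v ≟ u + toℕ j)

  n≤diagonalSize+∣1+s-n∣ : ∀ n s → n ≤ diagonalSize n s + ∣ suc s - n ∣
  n≤diagonalSize+∣1+s-n∣ n s = n≤∑+∣p-q∣ (suc s) n _ onDiagonal
    where
    onDiagonal : ∀ i → suc s ≤ toℕ i + n → toℕ i + n < suc s + n → 1 ≤ ∑[ j < n ] 𝟙 (toℕ i + toℕ j ≟ s)
    onDiagonal i lo hi = 1≤∑𝟙 (λ j → toℕ i + toℕ j ≟ s) (fromℕ< s∸i<n) (trans (cong (toℕ i +_) (toℕ-fromℕ< s∸i<n)) (m+[n∸m]≡n i≤s))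
      where
      i≤s : toℕ i ≤ s
      i≤s = s≤s⁻¹ (+-cancelʳ-< n (toℕ i) (suc s) hi)
      s∸i<n : s ∸ toℕ i < n
      s∸i<n = subst (s ∸ toℕ i <_) (m+n∸m≡n (toℕ i) n) (∸-monoˡ-< lo i≤s)

  n≤antidiagonalSize+∣u-v∣ : ∀ n u v → n ≤ antidiagonalSize n u v + ∣ u - v ∣
  n≤antidiagonalSize+∣u-v∣ n u v = n≤∑+∣p-q∣ u v _ onAntidiagonal
    where
    onAntidiagonal : ∀ i → u ≤ toℕ i + v → toℕ i + v < u + n → 1 ≤ ∑[ j < n ] 𝟙 (toℕ i + v ≟ u + toℕ j)
    onAntidiagonal i lo hi = 1≤∑𝟙 (λ j → toℕ i + v ≟ u + toℕ j) (fromℕ< j<n) (sym (trans (cong (u +_) (toℕ-fromℕ< j<n)) (m+[n∸m]≡n lo)))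
      where
      j<n : toℕ i + v ∸ u < n
      j<n = subst (toℕ i + v ∸ u <_) (m+n∸m≡n u n) (∸-monoˡ-< hi lo)

  -- Twice the distance of line k from the central line (n − 1)/2.
  δ : ℕ → ℕ → ℕ
  δ n k = ∣ suc (k + k) - n ∣

  ∣m+o-n∣+o≤∣m+o+o-n∣⊔∣m-n∣ : ∀ m o n → ∣ m + o - n ∣ + o ≤ ∣ m + o + o - n ∣ ⊔ ∣ m - n ∣
  ∣m+o-n∣+o≤∣m+o+o-n∣⊔∣m-n∣ m o n with n ≤? m + o
  ... | yes n≤m+o = ≤-trans (≤-reflexive eq) (m≤m⊔n _ _)
    where
    open ≡-Reasoning
    eq : ∣ m + o - n ∣ + o ≡ ∣ m + o + o - n ∣
    eq = begin
      ∣ m + o - n ∣ + o  ≡⟨ cong (_+ o) (m≤n⇒∣n-m∣≡n∸m n≤m+o) ⟩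
      m + o ∸ n + o      ≡⟨ +-∸-comm o n≤m+o ⟨
      m + o + o ∸ n      ≡⟨ m≤n⇒∣n-m∣≡n∸m (≤-trans n≤m+o (m≤m+n _ o)) ⟨
      ∣ m + o + o - n ∣  ∎
  ... | no n≰m+o = ≤-trans (≤-reflexive eq) (m≤n⊔m _ _)
    where
    open ≡-Reasoning
    m+o≤n : m + o ≤ n
    m+o≤n = <⇒≤ (≰⇒> n≰m+o)
    eq : ∣ m + o - n ∣ + o ≡ ∣ m - n ∣
    eq = begin
      ∣ m + o - n ∣ + o  ≡⟨ cong (_+ o) (m≤n⇒∣m-n∣≡n∸m m+o≤n) ⟩
      n ∸ (m + o) + o    ≡⟨ cong (_+ o) (∸-+-assoc n m o) ⟨
      n ∸ m ∸ o + o      ≡⟨ m∸n+n≡m (m+n≤o⇒m≤o∸n o (subst (_≤ n) (+-comm m o) m+o≤n)) ⟩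
      n ∸ m              ≡⟨ m≤n⇒∣m-n∣≡n∸m (≤-trans (m≤m+n m o) m+o≤n) ⟨
      ∣ m - n ∣          ∎

  ∣1+u+v-n∣+∣u-v∣≤δu⊔δv : ∀ n u v → ∣ suc (u + v) - n ∣ + ∣ u - v ∣ ≤ δ n u ⊔ δ n v
  ∣1+u+v-n∣+∣u-v∣≤δu⊔δv n u v = [ ordered u v , swapped ]′ (≤-total v u)
    where
    ordered : ∀ u v → v ≤ u → ∣ suc (u + v) - n ∣ + ∣ u - v ∣ ≤ δ n u ⊔ δ n v
    ordered u v v≤u with d , refl ← m≤n⇒∃[o]m+o≡n v≤u =
      subst₂ _≤_ (cong₂ _+_ (cong (λ k → ∣ suc k - n ∣) (l₁ v d)) (sym (trans (∣-∣-comm (v + d) v) (∣m-m+n∣≡n v d))))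
                 (cong (λ k → ∣ suc k - n ∣ ⊔ δ n v) (l₂ v d))
                 (∣m+o-n∣+o≤∣m+o+o-n∣⊔∣m-n∣ (suc (v + v)) d n)
      where
      l₁ : ∀ v d → v + v + d ≡ v + d + v
      l₁ = solve-∀
      l₂ : ∀ v d → v + v + d + d ≡ v + d + (v + d)
      l₂ = solve-∀
    swapped : u ≤ v → ∣ suc (u + v) - n ∣ + ∣ u - v ∣ ≤ δ n u ⊔ δ n v
    swapped u≤v = subst₂ _≤_ (cong₂ _+_ (cong (λ k → ∣ suc k - n ∣) (+-comm v u)) (∣-∣-comm v u)) (⊔-comm (δ n v) (δ n u))
                             (ordered v u u≤v)

  -- ψ linearises the maximum (4*[s⊔t]≤ψs+ψt), so that the rows and the columns of the queens
  -- can be summed separately.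
  ψ : ℕ → ℕ → ℕ
  ψ n t = n + 2 * (2 * t ∸ n)

  4*[s⊔t]≤ψs+ψt : ∀ n s t → 4 * (s ⊔ t) ≤ ψ n s + ψ n t
  4*[s⊔t]≤ψs+ψt n s t = [ ordered s t , swapped ]′ (≤-total t s)
    where
    ordered : ∀ s t → t ≤ s → 4 * (s ⊔ t) ≤ ψ n s + ψ n t
    ordered s t t≤s = begin
      4 * (s ⊔ t)            ≡⟨ cong (4 *_) (m≥n⇒m⊔n≡m t≤s) ⟩
      4 * s                  ≡⟨ l₁ s ⟩
      2 * (2 * s)            ≤⟨ *-monoʳ-≤ 2 (m≤n+m∸n (2 * s) n) ⟩
      2 * (n + (2 * s ∸ n))  ≡⟨ l₂ n (2 * s ∸ n) ⟩
      ψ n s + n              ≤⟨ +-monoʳ-≤ (ψ n s) (m≤m+n n _) ⟩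
      ψ n s + ψ n t          ∎
      where
      open ≤-Reasoning
      l₁ : ∀ s → 4 * s ≡ 2 * (2 * s)
      l₁ = solve-∀
      l₂ : ∀ n k → 2 * (n + k) ≡ n + 2 * k + n
      l₂ = solve-∀
    swapped : s ≤ t → 4 * (s ⊔ t) ≤ ψ n s + ψ n t
    swapped s≤t = subst₂ _≤_ (cong (4 *_) (⊔-comm t s)) (+-comm (ψ n t) (ψ n s)) (ordered t s s≤t)

  [y∸t]²+8[y+2∸t]≤[y+4∸t]² : ∀ y t → (y ∸ t) * (y ∸ t) + 8 * (y + 2 ∸ t) ≤ (y + 4 ∸ t) * (y + 4 ∸ t)
  [y∸t]²+8[y+2∸t]≤[y+4∸t]² y       zero                = ≤-reflexive (l y)
    where
    l : ∀ y → y * y + 8 * (y + 2) ≡ (y + 4) * (y + 4)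
    l = solve-∀
  [y∸t]²+8[y+2∸t]≤[y+4∸t]² zero    (suc zero)          = m≤m+n 8 1
  [y∸t]²+8[y+2∸t]≤[y+4∸t]² zero    (suc (suc zero))    = z≤n
  [y∸t]²+8[y+2∸t]≤[y+4∸t]² zero    (suc (suc (suc _))) = z≤n
  [y∸t]²+8[y+2∸t]≤[y+4∸t]² (suc y) (suc t)             = [y∸t]²+8[y+2∸t]≤[y+4∸t]² y t

  ∑-toℕ-init-last : ∀ m (f : ℕ → ℕ) → ∑[ i < suc m ] f (toℕ i) ≡ ∑[ i < m ] f (toℕ i) + f m
  ∑-toℕ-init-last m f = trans (sum-init-last {m} (f ∘ toℕ))
    (cong₂ _+_ (sum-cong-≗ {m} (cong f ∘ toℕ-inject₁)) (cong f (toℕ-fromℕ m)))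

  δ-shift : ∀ m k → δ (suc (suc m)) (suc k) ≡ δ m k
  δ-shift m k = cong (λ j → ∣ j - m ∣) (+-suc k k)

  δ-last : ∀ m → δ m m ≡ suc m
  δ-last m = trans (∣-∣-comm (suc (m + m)) m) (trans (cong (λ j → ∣ m - j ∣) (sym (+-suc m m))) (∣m-m+n∣≡n m (suc m)))

  -- Induction in steps of two: removing the first and the last line turns δ (m + 2) into δ m.
  4*∑[2δ∸t]≤[2m∸t]² : ∀ m t → 4 * ∑[ b < m ] (2 * δ m (toℕ b) ∸ t) ≤ (2 * m ∸ t) * (2 * m ∸ t)
  4*∑[2δ∸t]≤[2m∸t]² zero          t = z≤n
  4*∑[2δ∸t]≤[2m∸t]² (suc zero)    t rewrite 0∸n≡0 t = z≤n
  4*∑[2δ∸t]≤[2m∸t]² (suc (suc m)) t = begin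
    4 * ∑[ b < suc (suc m) ] F (toℕ b)                    ≡⟨ cong (4 *_) peel ⟩
    4 * (w + (∑[ b < m ] (2 * δ m (toℕ b) ∸ t) + w))      ≡⟨ l₁ w _ ⟩
    4 * ∑[ b < m ] (2 * δ m (toℕ b) ∸ t) + 8 * w           ≤⟨ +-monoˡ-≤ (8 * w) (4*∑[2δ∸t]≤[2m∸t]² m t) ⟩
    (2 * m ∸ t) * (2 * m ∸ t) + 8 * w                      ≡⟨ cong (λ k → (2 * m ∸ t) * (2 * m ∸ t) + 8 * (k ∸ t)) (l₂ m) ⟩
    (2 * m ∸ t) * (2 * m ∸ t) + 8 * (2 * m + 2 ∸ t)        ≤⟨ [y∸t]²+8[y+2∸t]≤[y+4∸t]² (2 * m) t ⟩
    (2 * m + 4 ∸ t) * (2 * m + 4 ∸ t)                      ≡⟨ cong (λ k → (k ∸ t) * (k ∸ t)) (l₃ m) ⟩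
    (2 * suc (suc m) ∸ t) * (2 * suc (suc m) ∸ t)          ∎
    where
    open ≤-Reasoning
    F : ℕ → ℕ
    F k = 2 * δ (suc (suc m)) k ∸ t
    w : ℕ
    w = 2 * suc m ∸ t
    peel : ∑[ b < suc (suc m) ] F (toℕ b) ≡ w + (∑[ b < m ] (2 * δ m (toℕ b) ∸ t) + w)
    peel = cong (w +_) (trans (∑-toℕ-init-last m (F ∘ suc))
             (cong₂ _+_ (sum-cong-≗ {m} (λ b → cong (λ k → 2 * k ∸ t) (δ-shift m (toℕ b))))
                        (cong (λ k → 2 * k ∸ t) (trans (δ-shift m m) (δ-last m)))))
    l₁ : ∀ w s → 4 * (w + (s + w)) ≡ 4 * s + 8 * w
    l₁ = solve-∀
    l₂ : ∀ m → 2 * suc m ≡ 2 * m + 2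
    l₂ = solve-∀
    l₃ : ∀ m → 2 * m + 4 ≡ 2 * suc (suc m)
    l₃ = solve-∀

  2*∑ψδ≤3n² : ∀ n → 2 * ∑[ b < n ] ψ n (δ n (toℕ b)) ≤ 3 * (n * n)
  2*∑ψδ≤3n² n = begin
    2 * ∑[ b < n ] ψ n (δ n (toℕ b))                      ≡⟨ cong (2 *_) split ⟩
    2 * (n * n + 2 * ∑[ b < n ] (2 * δ n (toℕ b) ∸ n))     ≡⟨ l₁ (n * n) (∑[ b < n ] (2 * δ n (toℕ b) ∸ n)) ⟩
    2 * (n * n) + 4 * ∑[ b < n ] (2 * δ n (toℕ b) ∸ n)     ≤⟨ +-monoʳ-≤ (2 * (n * n)) (4*∑[2δ∸t]≤[2m∸t]² n n) ⟩
    2 * (n * n) + (2 * n ∸ n) * (2 * n ∸ n)                ≡⟨ cong (λ k → 2 * (n * n) + k * k) 2n∸n≡n ⟩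
    2 * (n * n) + n * n                                    ≡⟨ l₂ (n * n) ⟩
    3 * (n * n)                                            ∎
    where
    open ≤-Reasoning
    split : ∑[ b < n ] ψ n (δ n (toℕ b)) ≡ n * n + 2 * ∑[ b < n ] (2 * δ n (toℕ b) ∸ n)
    split = trans (∑-distrib-+ {n} (λ _ → n) _) (cong₂ _+_ (∑-const n n) (sym (*-distribˡ-sum {n} 2 _)))
    2n∸n≡n : 2 * n ∸ n ≡ n
    2n∸n≡n = trans (cong (_∸ n) (cong (n +_) (+-identityʳ n))) (m+n∸m≡n n n)
    l₁ : ∀ a s → 2 * (a + 2 * s) ≡ 2 * a + 4 * s
    l₁ = solve-∀
    l₂ : ∀ a → 2 * a + a ≡ 3 * a
    l₂ = solve-∀

  8n≤4[D+A]+ψδu+ψδv : ∀ n u v →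
    8 * n ≤ 4 * (diagonalSize n (u + v) + antidiagonalSize n u v) + (ψ n (δ n u) + ψ n (δ n v))
  8n≤4[D+A]+ψδu+ψδv n u v = begin
    8 * n                                   ≡⟨ l₁ n ⟩
    4 * (n + n)                             ≤⟨ *-monoʳ-≤ 4 (+-mono-≤ (n≤diagonalSize+∣1+s-n∣ n (u + v)) (n≤antidiagonalSize+∣u-v∣ n u v)) ⟩
    4 * ((D + ∣ suc (u + v) - n ∣) + (A + ∣ u - v ∣))  ≡⟨ l₂ D _ A _ ⟩
    4 * (D + A) + 4 * (∣ suc (u + v) - n ∣ + ∣ u - v ∣)  ≤⟨ +-monoʳ-≤ (4 * (D + A)) (*-monoʳ-≤ 4 (∣1+u+v-n∣+∣u-v∣≤δu⊔δv n u v)) ⟩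
    4 * (D + A) + 4 * (δ n u ⊔ δ n v)       ≤⟨ +-monoʳ-≤ (4 * (D + A)) (4*[s⊔t]≤ψs+ψt n (δ n u) (δ n v)) ⟩
    4 * (D + A) + (ψ n (δ n u) + ψ n (δ n v))  ∎
    where
    open ≤-Reasoning
    D A : ℕ
    D = diagonalSize n (u + v)
    A = antidiagonalSize n u v
    l₁ : ∀ n → 8 * n ≡ 4 * (n + n)
    l₁ = solve-∀
    l₂ : ∀ d x a y → 4 * ((d + x) + (a + y)) ≡ 4 * (d + a) + 4 * (x + y)
    l₂ = solve-∀

module QueenCounting where

  open Counting
  open Diagonals
  open import Data.Nat.Base using (ℕ; zero; suc; _+_; _*_; _≤_; z≤n; s≤s)
  open import Data.Nat.Properties hiding (_≟_)
  import Data.Nat.Properties as ℕ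
  open import Data.Fin.Base using (Fin; toℕ)
  open import Data.Fin.Properties using (toℕ-injective) renaming (_≟_ to _≟ᶠ_)
  open import Data.Product.Base using (_×_; _,_; proj₁; proj₂)
  open import Data.Sum.Base using (_⊎_; inj₁; inj₂)
  open import Function.Base using (id; _∘_)
  open import Function.Definitions using (Injective)
  open import Relation.Nullary using (Dec; yes; no; ¬_)
  open import Relation.Nullary.Decidable using (¬?; _×-dec_; _⊎-dec_; decidable-stable)
  open import Relation.Binary.PropositionalEquality
  open import Data.Nat.Tactic.RingSolver using (solve-∀)

  m+n≡o+p∧m+p≡o+n⇒m≡o : ∀ m n o p → m + n ≡ o + p → m + p ≡ o + n → m ≡ o
  m+n≡o+p∧m+p≡o+n⇒m≡o m n o p eq₁ eq₂ = *-cancelˡ-≡ m o 2 (+-cancelʳ-≡ (n + p) (2 * m) (2 * o) (begin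
    2 * m + (n + p)      ≡⟨ l₁ m n p ⟩
    (m + n) + (m + p)    ≡⟨ cong₂ _+_ eq₁ eq₂ ⟩
    (o + p) + (o + n)    ≡⟨ l₂ o n p ⟩
    2 * o + (n + p)      ∎))
    where
    open ≡-Reasoning
    l₁ : ∀ m n p → 2 * m + (n + p) ≡ (m + n) + (m + p)
    l₁ = solve-∀
    l₂ : ∀ o n p → (o + p) + (o + n) ≡ 2 * o + (n + p)
    l₂ = solve-∀

  m+n≡o+p∧m+q≡r+p⇒o+q≡r+n : ∀ m n o p q r → m + n ≡ o + p → m + q ≡ r + p → o + q ≡ r + n
  m+n≡o+p∧m+q≡r+p⇒o+q≡r+n m n o p q r eq₁ eq₂ = +-cancelʳ-≡ (m + p) (o + q) (r + n) (begin
    o + q + (m + p)      ≡⟨ l₁ o q m p ⟩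
    (o + p) + (m + q)    ≡⟨ cong₂ _+_ (sym eq₁) eq₂ ⟩
    (m + n) + (r + p)    ≡⟨ l₂ m n r p ⟩
    r + n + (m + p)      ∎)
    where
    open ≡-Reasoning
    l₁ : ∀ o q m p → o + q + (m + p) ≡ (o + p) + (m + q)
    l₁ = solve-∀
    l₂ : ∀ m n r p → (m + n) + (r + p) ≡ r + n + (m + p)
    l₂ = solve-∀

  w+[N+d]≤3N∧8N≤4d+3N⇒4w≤3N : ∀ w N d → w + (N + d) ≤ 3 * N → 8 * N ≤ 4 * d + 3 * N → 4 * w ≤ 3 * N
  w+[N+d]≤3N∧8N≤4d+3N⇒4w≤3N w N d h₁ h₂ = +-cancelʳ-≤ (12 * N) (4 * w) (3 * N) (begin
    4 * w + 12 * N                   ≡⟨ l₁ w N ⟩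
    4 * w + 4 * N + 8 * N            ≤⟨ +-monoʳ-≤ (4 * w + 4 * N) h₂ ⟩
    4 * w + 4 * N + (4 * d + 3 * N)  ≡⟨ l₂ w N d ⟩
    4 * (w + (N + d)) + 3 * N        ≤⟨ +-monoˡ-≤ (3 * N) (*-monoʳ-≤ 4 h₁) ⟩
    4 * (3 * N) + 3 * N              ≡⟨ l₃ N ⟩
    3 * N + 12 * N                   ∎)
    where
    open ≤-Reasoning
    l₁ : ∀ w N → 4 * w + 12 * N ≡ 4 * w + 4 * N + 8 * N
    l₁ = solve-∀
    l₂ : ∀ w N d → 4 * w + 4 * N + (4 * d + 3 * N) ≡ 4 * (w + (N + d)) + 3 * N
    l₂ = solve-∀
    l₃ : ∀ N → 4 * (3 * N) + 3 * N ≡ 3 * N + 12 * N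
    l₃ = solve-∀

  2𝟙[ρ≡1]+𝟙[ρ≡2]+ρ≤3 : ∀ {p} {P : Set p} (P? : Dec P) {ρ} → ρ ≤ 3 →
                        2 * 𝟙 (P? ×-dec (ρ ℕ.≟ 1)) + 𝟙 (P? ×-dec (ρ ℕ.≟ 2)) + ρ ≤ 3
  2𝟙[ρ≡1]+𝟙[ρ≡2]+ρ≤3 (no _)  ρ≤3 = ρ≤3
  2𝟙[ρ≡1]+𝟙[ρ≡2]+ρ≤3 (yes _) {0} _ = z≤n
  2𝟙[ρ≡1]+𝟙[ρ≡2]+ρ≤3 (yes _) {1} _ = ≤-refl
  2𝟙[ρ≡1]+𝟙[ρ≡2]+ρ≤3 (yes _) {2} _ = ≤-refl
  2𝟙[ρ≡1]+𝟙[ρ≡2]+ρ≤3 (yes _) {3} _ = ≤-refl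
  2𝟙[ρ≡1]+𝟙[ρ≡2]+ρ≤3 (yes _) {suc (suc (suc (suc _)))} (s≤s (s≤s (s≤s ())))

  𝟙[ρ≡3]+𝟙[ρ≡2]+𝟙[ρ≡1]≤1 : ∀ {p} {P : Set p} (P? : Dec P) ρ →
                            𝟙 (P? ×-dec (ρ ℕ.≟ 3)) + 𝟙 (P? ×-dec (ρ ℕ.≟ 2)) + 𝟙 (P? ×-dec (ρ ℕ.≟ 1)) ≤ 1
  𝟙[ρ≡3]+𝟙[ρ≡2]+𝟙[ρ≡1]≤1 (no _)  _ = z≤n
  𝟙[ρ≡3]+𝟙[ρ≡2]+𝟙[ρ≡1]≤1 (yes _) 0 = z≤n
  𝟙[ρ≡3]+𝟙[ρ≡2]+𝟙[ρ≡1]≤1 (yes _) 1 = ≤-refl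
  𝟙[ρ≡3]+𝟙[ρ≡2]+𝟙[ρ≡1]≤1 (yes _) 2 = ≤-refl
  𝟙[ρ≡3]+𝟙[ρ≡2]+𝟙[ρ≡1]≤1 (yes _) 3 = ≤-refl
  𝟙[ρ≡3]+𝟙[ρ≡2]+𝟙[ρ≡1]≤1 (yes _) (suc (suc (suc (suc _)))) = z≤n

  module Placement {n : ℕ} (X : Fin n → Fin n) where

    column? : (j a : Fin n) → Dec (X a ≡ j)
    column? j a = X a ≟ᶠ j

    diagonal? : (i j a : Fin n) → Dec (toℕ i + toℕ j ≡ toℕ a + toℕ (X a))
    diagonal? i j a = toℕ i + toℕ j ℕ.≟ toℕ a + toℕ (X a)

    antidiagonal? : (i j a : Fin n) → Dec (toℕ i + toℕ (X a) ≡ toℕ a + toℕ j)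
    antidiagonal? i j a = toℕ i + toℕ (X a) ℕ.≟ toℕ a + toℕ j

    linesThrough : Fin n → Fin n → Fin n → ℕ
    linesThrough i j a = 𝟙 (column? j a) + (𝟙 (diagonal? i j a) + 𝟙 (antidiagonal? i j a))

    attackedBy : Fin n → Fin n → Fin n → ℕ
    attackedBy i j a = 𝟙 (¬? (i ≟ᶠ a) ×-dec attacks? X i j a)

    r≡∑attackedBy : ∀ i j → r X i j ≡ ∑[ a < n ] attackedBy i j a
    r≡∑attackedBy i j = length-filter-tabulate (λ a → ¬? (i ≟ᶠ a) ×-dec attacks? X i j a) id

    -- Off row a the three lines through (i, j) meet only at (i, j), so at most one contains the queen.
    attackedBy≡linesThrough : ∀ {i a} j → i ≢ a → attackedBy i j a ≡ linesThrough i j a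
    attackedBy≡linesThrough {i} {a} j i≢a = begin
      attackedBy i j a
        ≡⟨ 𝟙-×-yes i≢a (¬? (i ≟ᶠ a)) (attacks? X i j a) ⟩
      𝟙 (column? j a ⊎-dec (diagonal? i j a ⊎-dec antidiagonal? i j a))
        ≡⟨ 𝟙-⊎ column∩lines=∅ (column? j a) (diagonal? i j a ⊎-dec antidiagonal? i j a) ⟩
      𝟙 (column? j a) + 𝟙 (diagonal? i j a ⊎-dec antidiagonal? i j a)
        ≡⟨ cong (𝟙 (column? j a) +_) (𝟙-⊎ diagonal∩antidiagonal=∅ (diagonal? i j a) (antidiagonal? i j a)) ⟩
      linesThrough i j a
        ∎
      where
      open ≡-Reasoning
      column∩lines=∅ : X a ≡ j → ¬ (toℕ i + toℕ j ≡ toℕ a + toℕ (X a) ⊎ toℕ i + toℕ (X a) ≡ toℕ a + toℕ j)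
      column∩lines=∅ refl (inj₁ eq) = i≢a (toℕ-injective (+-cancelʳ-≡ (toℕ (X a)) _ _ eq))
      column∩lines=∅ refl (inj₂ eq) = i≢a (toℕ-injective (+-cancelʳ-≡ (toℕ (X a)) _ _ eq))
      diagonal∩antidiagonal=∅ : toℕ i + toℕ j ≡ toℕ a + toℕ (X a) → ¬ (toℕ i + toℕ (X a) ≡ toℕ a + toℕ j)
      diagonal∩antidiagonal=∅ eq₁ eq₂ = i≢a (toℕ-injective (m+n≡o+p∧m+p≡o+n⇒m≡o _ _ _ _ eq₁ eq₂))

    attackedBy≤linesThrough : ∀ i j a → attackedBy i j a ≤ linesThrough i j a
    attackedBy≤linesThrough i j a = split (i ≟ᶠ a)
      where
      split : Dec (i ≡ a) → attackedBy i j a ≤ linesThrough i j a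
      split (yes refl) = ≤-trans (≤-reflexive (𝟙-no (λ (i≢i , _) → i≢i refl) (¬? (i ≟ᶠ i) ×-dec attacks? X i j i))) z≤n
      split (no i≢a)   = ≤-reflexive (attackedBy≡linesThrough j i≢a)

    linesThrough≤attackedBy+own : ∀ i j a → linesThrough i j a ≤ attackedBy i j a + 𝟙 (a ≟ᶠ i) * linesThrough i j a
    linesThrough≤attackedBy+own i j a = split (a ≟ᶠ i)
      where
      split : (a≟i : Dec (a ≡ i)) → linesThrough i j a ≤ attackedBy i j a + 𝟙 a≟i * linesThrough i j a
      split (yes refl) = subst (linesThrough i j i ≤_) (cong (attackedBy i j i +_) (sym (+-identityʳ _))) (m≤n+m (linesThrough i j i) (attackedBy i j i))
      split (no a≢i)   = ≤-trans (≤-reflexive (sym (attackedBy≡linesThrough j (a≢i ∘ sym)))) (m≤m+n _ _)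

    attacksOf : Fin n → ℕ
    attacksOf a = ∑[ i < n ] ∑[ j < n ] attackedBy i j a

    diagonalsSize : Fin n → ℕ
    diagonalsSize a = diagonalSize n (toℕ a + toℕ (X a)) + antidiagonalSize n (toℕ a) (toℕ (X a))

    ∑linesThrough≡n+diagonalsSize : ∀ a → ∑[ i < n ] ∑[ j < n ] linesThrough i j a ≡ n + diagonalsSize a
    ∑linesThrough≡n+diagonalsSize a = begin
      ∑[ i < n ] ∑[ j < n ] linesThrough i j a
        ≡⟨ sum-cong-≗ {n} (λ i → trans (∑-distrib-+ {n} _ _) (cong (∑[ j < n ] 𝟙 (column? j a) +_) (∑-distrib-+ {n} _ _))) ⟩
      ∑[ i < n ] (∑[ j < n ] 𝟙 (column? j a) + (D i + A i))
        ≡⟨ ∑-distrib-+ {n} _ _ ⟩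
      ∑[ i < n ] ∑[ j < n ] 𝟙 (column? j a) + ∑[ i < n ] (D i + A i)
        ≡⟨ cong₂ _+_ (trans (sum-cong-≗ {n} (λ _ → ∑𝟙[c≟i]≡1 (X a))) (trans (∑-const n 1) (*-identityʳ n))) (∑-distrib-+ {n} D A) ⟩
      n + diagonalsSize a  ∎
      where
      open ≡-Reasoning
      D A : Fin n → ℕ
      D i = ∑[ j < n ] 𝟙 (diagonal? i j a)
      A i = ∑[ j < n ] 𝟙 (antidiagonal? i j a)

    ∑linesThrough-own≤3 : ∀ a → ∑[ j < n ] linesThrough a j a ≤ 3
    ∑linesThrough-own≤3 a = begin
      ∑[ j < n ] linesThrough a j a  ≡⟨ ∑-distrib-+ {n} _ _ ⟩
      _ + ∑[ j < n ] (𝟙 (diagonal? a j a) + 𝟙 (antidiagonal? a j a)) ≡⟨ cong (∑[ j < n ] 𝟙 (column? j a) +_) (∑-distrib-+ {n} _ _) ⟩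
      ∑[ j < n ] 𝟙 (column? j a) + (∑[ j < n ] 𝟙 (diagonal? a j a) + ∑[ j < n ] 𝟙 (antidiagonal? a j a))
        ≤⟨ +-mono-≤ (∑-𝟙-unique≤1 (λ j → column? j a) (λ p q → trans (sym p) q))
                    (+-mono-≤ (∑-𝟙-unique≤1 (λ j → diagonal? a j a) (λ p q → toℕ-injective (+-cancelˡ-≡ (toℕ a) _ _ (trans p (sym q)))))
                              (∑-𝟙-unique≤1 (λ j → antidiagonal? a j a) (λ p q → toℕ-injective (+-cancelˡ-≡ (toℕ a) _ _ (trans (sym p) q))))) ⟩
      3  ∎
      where open ≤-Reasoning

    -- The column and the two diagonals of queen a have n + diagonalsSize a incidences with the board;
    -- the three at the queen's own square are not attacks.
    n+diagonalsSize≤attacksOf+3 : ∀ a → n + diagonalsSize a ≤ attacksOf a + 3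
    n+diagonalsSize≤attacksOf+3 a = begin
      n + diagonalsSize a                                                                ≡⟨ ∑linesThrough≡n+diagonalsSize a ⟨
      ∑[ i < n ] ∑[ j < n ] linesThrough i j a                                           ≤⟨ ∑-mono-≤ (λ i → ∑-mono-≤ (λ j → linesThrough≤attackedBy+own i j a)) ⟩
      ∑[ i < n ] ∑[ j < n ] (attackedBy i j a + 𝟙 (a ≟ᶠ i) * linesThrough i j a)
        ≡⟨ sum-cong-≗ {n} (λ i → trans (∑-distrib-+ {n} _ _) (cong (∑[ j < n ] attackedBy i j a +_) (sym (*-distribˡ-sum {n} (𝟙 (a ≟ᶠ i)) _)))) ⟩
      ∑[ i < n ] (∑[ j < n ] attackedBy i j a + 𝟙 (a ≟ᶠ i) * ∑[ j < n ] linesThrough i j a)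
        ≡⟨ ∑-distrib-+ {n} _ _ ⟩
      attacksOf a + ∑[ i < n ] (𝟙 (a ≟ᶠ i) * ∑[ j < n ] linesThrough i j a)             ≡⟨ cong (attacksOf a +_) (∑𝟙[c≟i]*f[i]≡f[c] a _) ⟩
      attacksOf a + ∑[ j < n ] linesThrough a j a                                        ≤⟨ +-monoʳ-≤ (attacksOf a) (∑linesThrough-own≤3 a) ⟩
      attacksOf a + 3                                                                    ∎
      where open ≤-Reasoning

    ∑r≡∑attacksOf : ∑[ i < n ] ∑[ j < n ] r X i j ≡ ∑[ a < n ] attacksOf a
    ∑r≡∑attacksOf = begin
      ∑[ i < n ] ∑[ j < n ] r X i j                    ≡⟨ sum-cong-≗ {n} (λ i → sum-cong-≗ {n} (r≡∑attackedBy i)) ⟩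
      ∑[ i < n ] ∑[ j < n ] ∑[ a < n ] attackedBy i j a ≡⟨ sum-cong-≗ {n} (λ i → ∑-comm {n} {n} _) ⟩
      ∑[ i < n ] ∑[ a < n ] ∑[ j < n ] attackedBy i j a ≡⟨ ∑-comm {n} {n} _ ⟩
      ∑[ a < n ] attacksOf a                            ∎
      where open ≡-Reasoning

    rIs : Fin n → ℕ → Fin n → ℕ
    rIs i k j = 𝟙 (¬? (j ≟ᶠ X i) ×-dec (r X i j ℕ.≟ k))

    countR≡∑ : ∀ i k → countR X i k ≡ ∑[ j < n ] rIs i k j
    countR≡∑ i k = length-filter-tabulate (λ j → ¬? (j ≟ᶠ X i) ×-dec (r X i j ℕ.≟ k)) id

    a+b+c≤n : ∀ i → aR X i + bR X i + cR X i ≤ n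
    a+b+c≤n i = begin
      aR X i + bR X i + cR X i                               ≡⟨ cong₂ _+_ (cong₂ _+_ (countR≡∑ i 3) (countR≡∑ i 2)) (countR≡∑ i 1) ⟩
      ∑[ j < n ] rIs i 3 j + ∑[ j < n ] rIs i 2 j + ∑[ j < n ] rIs i 1 j
        ≡⟨ trans (∑-distrib-+ {n} _ (rIs i 1)) (cong (_+ ∑[ j < n ] rIs i 1 j) (∑-distrib-+ {n} (rIs i 3) (rIs i 2))) ⟨
      ∑[ j < n ] (rIs i 3 j + rIs i 2 j + rIs i 1 j)         ≤⟨ ∑-mono-≤ (λ j → 𝟙[ρ≡3]+𝟙[ρ≡2]+𝟙[ρ≡1]≤1 (¬? (j ≟ᶠ X i)) (r X i j)) ⟩
      ∑[ j < n ] 1                                           ≡⟨ ∑-const n 1 ⟩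
      n * 1                                                  ≡⟨ *-identityʳ n ⟩
      n                                                      ∎
      where open ≤-Reasoning

    module _ (queens : IsQueens n X) where

      ¬≢⇒≡ : ∀ {a b : Fin n} → ¬ a ≢ b → a ≡ b
      ¬≢⇒≡ {a} {b} = decidable-stable (a ≟ᶠ b)

      X-injective : Injective _≡_ _≡_ X
      X-injective eq = ¬≢⇒≡ (λ a≢b → proj₁ (queens _ _ a≢b) eq)

      r≤3 : ∀ i j → r X i j ≤ 3
      r≤3 i j = begin
        r X i j                                    ≡⟨ r≡∑attackedBy i j ⟩
        ∑[ a < n ] attackedBy i j a                ≤⟨ ∑-mono-≤ (attackedBy≤linesThrough i j) ⟩
        ∑[ a < n ] linesThrough i j a              ≡⟨ ∑-distrib-+ {n} _ _ ⟩
        _ + ∑[ a < n ] (𝟙 (diagonal? i j a) + 𝟙 (antidiagonal? i j a))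
          ≡⟨ cong (∑[ a < n ] 𝟙 (column? j a) +_) (∑-distrib-+ {n} _ _) ⟩
        ∑[ a < n ] 𝟙 (column? j a) + (∑[ a < n ] 𝟙 (diagonal? i j a) + ∑[ a < n ] 𝟙 (antidiagonal? i j a))
          ≤⟨ +-mono-≤ (∑-𝟙-unique≤1 (column? j) (λ p q → X-injective (trans p (sym q))))
                      (+-mono-≤ (∑-𝟙-unique≤1 (diagonal? i j) (λ p q → ¬≢⇒≡ (λ a≢b → proj₁ (proj₂ (queens _ _ a≢b)) (trans (sym p) q))))
                                (∑-𝟙-unique≤1 (antidiagonal? i j) (λ p q → ¬≢⇒≡ (λ a≢b → proj₂ (proj₂ (queens _ _ a≢b))
                                                                    (m+n≡o+p∧m+q≡r+p⇒o+q≡r+n (toℕ i) _ _ _ _ _ p q))))) ⟩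
        3                                          ∎
        where open ≤-Reasoning

      r[i,Xi]≡0 : ∀ i → r X i (X i) ≡ 0
      r[i,Xi]≡0 i = trans (r≡∑attackedBy i (X i)) (∑-zero (λ a → 𝟙-no (unattacked a) (¬? (i ≟ᶠ a) ×-dec attacks? X i (X i) a)))
        where
        unattacked : ∀ a → ¬ (i ≢ a × Attacks X i (X i) a)
        unattacked a (i≢a , inj₁ eq)        = proj₁ (queens i a i≢a) (sym eq)
        unattacked a (i≢a , inj₂ (inj₁ eq)) = proj₁ (proj₂ (queens i a i≢a)) eq
        unattacked a (i≢a , inj₂ (inj₂ eq)) = proj₂ (proj₂ (queens i a i≢a)) eq

      -- Pointwise: 2[r = 1] + [r = 2] + r ≤ 3 off the queen since r ≤ 3, and r = 0 on the queen.
      2c+b+∑r+3≤3n : ∀ i → 2 * cR X i + bR X i + ∑[ j < n ] r X i j + 3 ≤ n * 3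
      2c+b+∑r+3≤3n i = begin
        2 * cR X i + bR X i + ∑[ j < n ] r X i j + 3
          ≡⟨ cong₂ (λ c b → 2 * c + b + ∑[ j < n ] r X i j + 3) (countR≡∑ i 1) (countR≡∑ i 2) ⟩
        2 * ∑[ j < n ] rIs i 1 j + ∑[ j < n ] rIs i 2 j + ∑[ j < n ] r X i j + 3
          ≡⟨ collect ⟨
        ∑[ j < n ] (2 * rIs i 1 j + rIs i 2 j + r X i j + 𝟙 (X i ≟ᶠ j) * 3)
          ≤⟨ ∑-mono-≤ pointwise ⟩
        ∑[ j < n ] 3
          ≡⟨ ∑-const n 3 ⟩
        n * 3
          ∎
        where
        open ≤-Reasoning
        collect : ∑[ j < n ] (2 * rIs i 1 j + rIs i 2 j + r X i j + 𝟙 (X i ≟ᶠ j) * 3)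
                ≡ 2 * ∑[ j < n ] rIs i 1 j + ∑[ j < n ] rIs i 2 j + ∑[ j < n ] r X i j + 3
        collect = trans (∑-distrib-+ {n} _ _) (cong₂ _+_
          (trans (∑-distrib-+ {n} _ _) (cong (_+ ∑[ j < n ] r X i j)
            (trans (∑-distrib-+ {n} _ _) (cong (_+ ∑[ j < n ] rIs i 2 j) (sym (*-distribˡ-sum {n} 2 (rIs i 1)))))))
          (∑𝟙[c≟i]*f[i]≡f[c] (X i) (λ _ → 3)))
        pointwise : ∀ j → 2 * rIs i 1 j + rIs i 2 j + r X i j + 𝟙 (X i ≟ᶠ j) * 3 ≤ 3
        pointwise j = split (j ≟ᶠ X i)
          where
          split : Dec (j ≡ X i) → 2 * rIs i 1 j + rIs i 2 j + r X i j + 𝟙 (X i ≟ᶠ j) * 3 ≤ 3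
          split (yes refl) = ≤-reflexive (cong₂ _+_ (cong₂ _+_ (cong₂ _+_ (cong (2 *_) (notCounted 1)) (notCounted 2)) (r[i,Xi]≡0 i))
                                                     (cong (_* 3) (𝟙-yes refl (X i ≟ᶠ X i))))
            where
            notCounted : ∀ k → rIs i k (X i) ≡ 0
            notCounted k = 𝟙-no (λ (Xi≢Xi , _) → Xi≢Xi refl) (¬? (X i ≟ᶠ X i) ×-dec (r X i (X i) ℕ.≟ k))
          split (no j≢Xi)  = subst (_≤ 3) (sym (trans (cong (2 * rIs i 1 j + rIs i 2 j + r X i j +_) (cong (_* 3) (𝟙-no (j≢Xi ∘ sym) (X i ≟ᶠ j))))
                                                      (+-identityʳ _)))
                                   (2𝟙[ρ≡1]+𝟙[ρ≡2]+ρ≤3 (¬? (j ≟ᶠ X i)) (r≤3 i j))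

      ∑[2c+b]+n²+∑diagonalsSize≤3n² : ∑[ i < n ] (2 * cR X i + bR X i) + (n * n + ∑[ a < n ] diagonalsSize a) ≤ 3 * (n * n)
      ∑[2c+b]+n²+∑diagonalsSize≤3n² = begin
        W + (n * n + ∑[ a < n ] diagonalsSize a)
          ≡⟨ cong (W +_) (trans (∑-distrib-+ {n} (λ _ → n) diagonalsSize) (cong (_+ ∑[ a < n ] diagonalsSize a) (∑-const n n))) ⟨
        W + ∑[ a < n ] (n + diagonalsSize a)               ≤⟨ +-monoʳ-≤ W (∑-mono-≤ n+diagonalsSize≤attacksOf+3) ⟩
        W + ∑[ a < n ] (attacksOf a + 3)                   ≡⟨ cong (W +_) (trans (∑-distrib-+ {n} _ _) (cong₂ _+_ (sym ∑r≡∑attacksOf) (∑-const n 3))) ⟩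
        W + (∑[ i < n ] ∑[ j < n ] r X i j + n * 3)        ≡⟨ +-assoc W _ _ ⟨
        W + ∑[ i < n ] ∑[ j < n ] r X i j + n * 3          ≡⟨ trans (∑-distrib-+ {n} _ _) (cong₂ _+_ (∑-distrib-+ {n} _ _) (∑-const n 3)) ⟨
        ∑[ i < n ] (2 * cR X i + bR X i + ∑[ j < n ] r X i j + 3)  ≤⟨ ∑-mono-≤ 2c+b+∑r+3≤3n ⟩
        ∑[ i < n ] (n * 3)                                 ≡⟨ ∑-const n (n * 3) ⟩
        n * (n * 3)                                        ≡⟨ l n ⟩
        3 * (n * n)                                        ∎
        where
        open ≤-Reasoning
        W : ℕ
        W = ∑[ i < n ] (2 * cR X i + bR X i)
        l : ∀ n → n * (n * 3) ≡ 3 * (n * n)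
        l = solve-∀

      8n²≤4∑diagonalsSize+3n² : 8 * (n * n) ≤ 4 * ∑[ a < n ] diagonalsSize a + 3 * (n * n)
      8n²≤4∑diagonalsSize+3n² = begin
        8 * (n * n)                                        ≡⟨ trans (l n) (sym (∑-const n (8 * n))) ⟩
        ∑[ a < n ] (8 * n)                                 ≤⟨ ∑-mono-≤ (λ a → 8n≤4[D+A]+ψδu+ψδv n (toℕ a) (toℕ (X a))) ⟩
        ∑[ a < n ] (4 * diagonalsSize a + (Γ a + Γ (X a)))  ≡⟨ trans (∑-distrib-+ {n} _ _) (cong₂ _+_ (sym (*-distribˡ-sum {n} 4 _)) (∑-distrib-+ {n} _ _)) ⟩
        4 * ∑[ a < n ] diagonalsSize a + (∑Γ + ∑[ a < n ] Γ (X a))  ≤⟨ +-monoʳ-≤ (4 * ∑[ a < n ] diagonalsSize a) (+-monoʳ-≤ ∑Γ (∑-∘-injective≤∑ X-injective Γ)) ⟩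
        4 * ∑[ a < n ] diagonalsSize a + (∑Γ + ∑Γ)          ≡⟨ cong (4 * ∑[ a < n ] diagonalsSize a +_) (cong (∑Γ +_) (sym (+-identityʳ ∑Γ))) ⟩
        4 * ∑[ a < n ] diagonalsSize a + 2 * ∑Γ             ≤⟨ +-monoʳ-≤ (4 * ∑[ a < n ] diagonalsSize a) (2*∑ψδ≤3n² n) ⟩
        4 * ∑[ a < n ] diagonalsSize a + 3 * (n * n)        ∎
        where
        open ≤-Reasoning
        Γ : Fin n → ℕ
        Γ b = ψ n (δ n (toℕ b))
        ∑Γ : ℕ
        ∑Γ = ∑[ b < n ] Γ b
        l : ∀ n → 8 * (n * n) ≡ n * (8 * n)
        l = solve-∀

      4∑[2c+b]≤3n² : 4 * ∑[ i < n ] (2 * cR X i + bR X i) ≤ 3 * (n * n)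
      4∑[2c+b]≤3n² = w+[N+d]≤3N∧8N≤4d+3N⇒4w≤3N (∑[ i < n ] (2 * cR X i + bR X i)) (n * n) (∑[ a < n ] diagonalsSize a)
                       ∑[2c+b]+n²+∑diagonalsSize≤3n² 8n²≤4∑diagonalsSize+3n²

module RationalInequalities where

  open import Data.Nat.Base as ℕ using (ℕ; zero; suc)
  open import Data.Integer.Base as ℤ using (+_)
  import Data.Integer.Properties as ℤ
  open import Data.Rational.Base
  open import Data.Rational.Properties
  open import Data.Fin.Base using (Fin; zero; suc)
  open import Data.List.Base using (foldr)
  open import Data.List.Properties using (map-tabulate)
  open import Data.Nat.Coprimality using (1-coprimeTo) renaming (sym to coprime-sym)
  open import Data.Sum.Base using (inj₁; inj₂)
  open import Function.Base using (_∘_; id)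
  open import Relation.Binary.PropositionalEquality
  open import Algebra.Bundles using (CommutativeRing)
  open import Algebra.Properties.Semiring.Sum (CommutativeRing.semiring +-*-commutativeRing)
  open import Data.Rational.Solver using (module +-*-Solver)
  open +-*-Solver using (solve; _:=_; _:+_; _:*_; _:-_; con)

  ℕ→ℚ≡mkℚ : ∀ m → ℕ→ℚ m ≡ mkℚ (+ m) 0 (coprime-sym (1-coprimeTo m))
  ℕ→ℚ≡mkℚ m = normalize-coprime (coprime-sym (1-coprimeTo m))

  ℕ→ℚ-homo-+ : ∀ a b → ℕ→ℚ (a ℕ.+ b) ≡ ℕ→ℚ a + ℕ→ℚ b
  ℕ→ℚ-homo-+ a b = sym (trans (cong₂ _+_ (ℕ→ℚ≡mkℚ a) (ℕ→ℚ≡mkℚ b))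
    (/-cong (cong₂ ℤ._+_ (ℤ.*-identityʳ (+ a)) (ℤ.*-identityʳ (+ b))) refl))

  ℕ→ℚ-homo-* : ∀ a b → ℕ→ℚ (a ℕ.* b) ≡ ℕ→ℚ a * ℕ→ℚ b
  ℕ→ℚ-homo-* a b = sym (trans (cong₂ _*_ (ℕ→ℚ≡mkℚ a) (ℕ→ℚ≡mkℚ b)) (/-cong (sym (ℤ.pos-* a b)) refl))

  ℕ→ℚ-mono-≤ : ∀ {a b} → a ℕ.≤ b → ℕ→ℚ a ≤ ℕ→ℚ b
  ℕ→ℚ-mono-≤ {a} {b} a≤b = subst₂ _≤_ (sym (ℕ→ℚ≡mkℚ a)) (sym (ℕ→ℚ≡mkℚ b))
    (*≤* (subst₂ ℤ._≤_ (sym (ℤ.*-identityʳ (+ a))) (sym (ℤ.*-identityʳ (+ b))) (ℤ.+≤+ a≤b)))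

  0≤ℕ→ℚ : ∀ a → 0ℚ ≤ ℕ→ℚ a
  0≤ℕ→ℚ a = ℕ→ℚ-mono-≤ {0} {a} ℕ.z≤n

  ∑-ℕ→ℚ : ∀ {n} (f : Fin n → ℕ) → ∑[ i < n ] ℕ→ℚ (f i) ≡ ℕ→ℚ (Counting.sum f)
  ∑-ℕ→ℚ {zero}  f = refl
  ∑-ℕ→ℚ {suc n} f = trans (cong (λ s → ℕ→ℚ (f zero) + s) (∑-ℕ→ℚ (f ∘ suc))) (sym (ℕ→ℚ-homo-+ (f zero) _))

  ∑-mono-≤ : ∀ {n} {f g : Fin n → ℚ} → (∀ i → f i ≤ g i) → ∑[ i < n ] f i ≤ ∑[ i < n ] g i
  ∑-mono-≤ {zero}  f≤g = ≤-refl
  ∑-mono-≤ {suc n} f≤g = +-mono-≤ (f≤g zero) (∑-mono-≤ (f≤g ∘ suc))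

  prodFin-suc : ∀ n (f : Fin (suc n) → ℚ) → prodFin (suc n) f ≡ f zero * prodFin n (f ∘ suc)
  prodFin-suc n f = cong (λ xs → f zero * foldr _*_ 1ℚ xs) (trans (map-tabulate suc f) (sym (map-tabulate id (f ∘ suc))))

  *-nonNeg : ∀ {p q} → 0ℚ ≤ p → 0ℚ ≤ q → 0ℚ ≤ p * q
  *-nonNeg {p} {q} 0≤p 0≤q = nonNegative⁻¹ _ {{nonNeg*nonNeg⇒nonNeg p {{nonNegative 0≤p}} q {{nonNegative 0≤q}}}}

  +-nonNeg : ∀ {p q} → 0ℚ ≤ p → 0ℚ ≤ q → 0ℚ ≤ p + q
  +-nonNeg {p} {q} 0≤p 0≤q = nonNegative⁻¹ _ {{nonNeg+nonNeg⇒nonNeg p {{nonNegative 0≤p}} q {{nonNegative 0≤q}}}}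

  *-monoʳ-≤-0≤ : ∀ {p q} r → 0ℚ ≤ r → p ≤ q → p * r ≤ q * r
  *-monoʳ-≤-0≤ r 0≤r = *-monoʳ-≤-nonNeg r {{nonNegative 0≤r}}

  *-monoˡ-≤-0≤ : ∀ {p q} r → 0ℚ ≤ r → p ≤ q → r * p ≤ r * q
  *-monoˡ-≤-0≤ r 0≤r = *-monoˡ-≤-nonNeg r {{nonNegative 0≤r}}

  p≤q⇒0≤q-p : ∀ {p q} → p ≤ q → 0ℚ ≤ q - p
  p≤q⇒0≤q-p {p} p≤q = ≤-trans (≤-reflexive (sym (+-inverseʳ p))) (+-monoˡ-≤ (- p) p≤q)

  p+d≡q⇒p≤q : ∀ {p q} d → 0ℚ ≤ d → p + d ≡ q → p ≤ q
  p+d≡q⇒p≤q {p} d 0≤d refl = ≤-trans (≤-reflexive (sym (+-identityʳ p))) (+-monoʳ-≤ p 0≤d)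

  0≤p*p : ∀ p → 0ℚ ≤ p * p
  0≤p*p p with ≤-total 0ℚ p
  ... | inj₁ 0≤p = *-nonNeg 0≤p 0≤p
  ... | inj₂ p≤0 = nonNegative⁻¹ _ {{nonPos*nonPos⇒nonPos p {{nonPositive p≤0}} p {{nonPositive p≤0}}}}

  0≤½ : 0ℚ ≤ ½
  0≤½ = nonNegative⁻¹ ½ {{normalize-nonNeg 1 2}}

  ^-nonNeg : ∀ {q} k → 0ℚ ≤ q → 0ℚ ≤ q ^ℚ k
  ^-nonNeg zero    0≤q = ℕ→ℚ-mono-≤ (ℕ.z≤n {1})
  ^-nonNeg (suc k) 0≤q = *-nonNeg 0≤q (^-nonNeg k 0≤q)

  ^-mono-≤ : ∀ {p q} k → 0ℚ ≤ p → p ≤ q → p ^ℚ k ≤ q ^ℚ k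
  ^-mono-≤ zero    0≤p p≤q = ≤-refl
  ^-mono-≤ {p} {q} (suc k) 0≤p p≤q =
    ≤-trans (*-monoʳ-≤-0≤ (p ^ℚ k) (^-nonNeg k 0≤p) p≤q) (*-monoˡ-≤-0≤ q (≤-trans 0≤p p≤q) (^-mono-≤ k 0≤p p≤q))

  ∑-nonNeg : ∀ {n} {f : Fin n → ℚ} → (∀ i → 0ℚ ≤ f i) → 0ℚ ≤ ∑[ i < n ] f i
  ∑-nonNeg {zero}  _   = ≤-refl
  ∑-nonNeg {suc n} 0≤f = +-nonNeg (0≤f zero) (∑-nonNeg (0≤f ∘ suc))

  rearrangement : ∀ p q P Q → (p ≤ q → P ≤ Q) → (q ≤ p → Q ≤ P) → p * Q + q * P ≤ p * P + q * Q
  rearrangement p q P Q mono₁ mono₂ with ≤-total p q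
  ... | inj₁ p≤q = p+d≡q⇒p≤q ((q - p) * (Q - P)) (*-nonNeg (p≤q⇒0≤q-p p≤q) (p≤q⇒0≤q-p (mono₁ p≤q))) (l p q P Q)
    where
    l : ∀ p q P Q → p * Q + q * P + (q - p) * (Q - P) ≡ p * P + q * Q
    l = solve 4 (λ p q P Q → p :* Q :+ q :* P :+ (q :- p) :* (Q :- P) := p :* P :+ q :* Q) refl
  ... | inj₂ q≤p = p+d≡q⇒p≤q ((p - q) * (P - Q)) (*-nonNeg (p≤q⇒0≤q-p q≤p) (p≤q⇒0≤q-p (mono₂ q≤p))) (l p q P Q)
    where
    l : ∀ p q P Q → p * Q + q * P + (p - q) * (P - Q) ≡ p * P + q * Q
    l = solve 4 (λ p q P Q → p :* Q :+ q :* P :+ (p :- q) :* (P :- Q) := p :* P :+ q :* Q) refl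

  [1+k]pq^k≤p^[1+k]+kq^[1+k] : ∀ k {p q} → 0ℚ ≤ p → 0ℚ ≤ q →
                                ℕ→ℚ (suc k) * p * q ^ℚ k ≤ p ^ℚ suc k + ℕ→ℚ k * q ^ℚ suc k
  [1+k]pq^k≤p^[1+k]+kq^[1+k] zero    {p} {q} _   _   = ≤-reflexive (l p q)
    where
    l : ∀ p q → 1ℚ * p * 1ℚ ≡ p * 1ℚ + 0ℚ * (q * 1ℚ)
    l = solve 2 (λ p q → con 1ℚ :* p :* con 1ℚ := p :* con 1ℚ :+ con 0ℚ :* (q :* con 1ℚ)) refl
  [1+k]pq^k≤p^[1+k]+kq^[1+k] (suc k) {p} {q} 0≤p 0≤q = begin
    ℕ→ℚ (suc (suc k)) * p * (q * qᵏ)                      ≡⟨ cong (λ c → c * p * (q * qᵏ)) (ℕ→ℚ-homo-+ 1 (suc k)) ⟩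
    (1ℚ + ℕ→ℚ (suc k)) * p * (q * qᵏ)                      ≡⟨ l₁ (ℕ→ℚ (suc k)) p q qᵏ ⟩
    p * (q * qᵏ) + q * (ℕ→ℚ (suc k) * p * qᵏ)               ≤⟨ +-monoʳ-≤ (p * (q * qᵏ)) (*-monoˡ-≤-0≤ q 0≤q ([1+k]pq^k≤p^[1+k]+kq^[1+k] k 0≤p 0≤q)) ⟩
    p * (q * qᵏ) + q * (p ^ℚ suc k + κ * (q * qᵏ))          ≡⟨ l₂ p q qᵏ (p ^ℚ suc k) κ ⟩
    (p * (q * qᵏ) + q * p ^ℚ suc k) + κ * (q * (q * qᵏ))
      ≤⟨ +-monoˡ-≤ (κ * (q * (q * qᵏ))) (rearrangement p q (p ^ℚ suc k) (q * qᵏ) (^-mono-≤ (suc k) 0≤p) (^-mono-≤ (suc k) 0≤q)) ⟩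
    (p * p ^ℚ suc k + q * (q * qᵏ)) + κ * (q * (q * qᵏ))    ≡⟨ l₃ p (p ^ℚ suc k) q qᵏ κ ⟩
    p * p ^ℚ suc k + (1ℚ + κ) * (q * (q * qᵏ))              ≡⟨ cong (λ c → p * p ^ℚ suc k + c * (q * (q * qᵏ))) (ℕ→ℚ-homo-+ 1 k) ⟨
    p ^ℚ suc (suc k) + ℕ→ℚ (suc k) * q ^ℚ suc (suc k)      ∎
    where
    open ≤-Reasoning
    qᵏ κ : ℚ
    qᵏ = q ^ℚ k
    κ = ℕ→ℚ k
    l₁ : ∀ c p q r → (1ℚ + c) * p * (q * r) ≡ p * (q * r) + q * (c * p * r)
    l₁ = solve 4 (λ c p q r → (con 1ℚ :+ c) :* p :* (q :* r) := p :* (q :* r) :+ q :* (c :* p :* r)) refl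
    l₂ : ∀ p q r P κ → p * (q * r) + q * (P + κ * (q * r)) ≡ (p * (q * r) + q * P) + κ * (q * (q * r))
    l₂ = solve 5 (λ p q r P κ → p :* (q :* r) :+ q :* (P :+ κ :* (q :* r)) := (p :* (q :* r) :+ q :* P) :+ κ :* (q :* (q :* r))) refl
    l₃ : ∀ p P q r κ → (p * P + q * (q * r)) + κ * (q * (q * r)) ≡ p * P + (1ℚ + κ) * (q * (q * r))
    l₃ = solve 5 (λ p P q r κ → (p :* P :+ q :* (q :* r)) :+ κ :* (q :* (q :* r)) := p :* P :+ (con 1ℚ :+ κ) :* (q :* (q :* r))) refl

  -- Induction applied to the last k + 1 terms with their own mean m′ leaves f 0 ≤ (k + 2)m − (k + 1)m′,
  -- and the weighted two-term inequality [1+k]pq^k≤p^[1+k]+kq^[1+k] closes the step.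
  am-gm : ∀ k (f : Fin k → ℚ) m → (∀ i → 0ℚ ≤ f i) → 0ℚ ≤ m → ∑[ i < k ] f i ≤ ℕ→ℚ k * m → prodFin k f ≤ m ^ℚ k
  am-gm zero          f m 0≤f 0≤m ∑f≤km = ≤-refl
  am-gm (suc zero)    f m 0≤f 0≤m ∑f≤km =
    *-monoʳ-≤-0≤ 1ℚ (^-nonNeg 0 0≤m) (subst₂ _≤_ (+-identityʳ (f zero)) (*-identityˡ m) ∑f≤km)
  am-gm (suc (suc k)) f m 0≤f 0≤m ∑f≤km = begin
    prodFin (suc (suc k)) f                           ≡⟨ prodFin-suc (suc k) f ⟩
    f zero * prodFin (suc k) (f ∘ suc)                ≤⟨ *-monoˡ-≤-0≤ (f zero) (0≤f zero) (am-gm (suc k) (f ∘ suc) m′ (0≤f ∘ suc) 0≤m′ ∑tail≤κm′) ⟩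
    f zero * m′ ^ℚ suc k                              ≤⟨ *-monoʳ-≤-0≤ (m′ ^ℚ suc k) (^-nonNeg (suc k) 0≤m′) f₀≤ ⟩
    (K * m - κ * m′) * m′ ^ℚ suc k                    ≡⟨ l K m κ m′ (m′ ^ℚ suc k) ⟩
    K * m * m′ ^ℚ suc k - κ * m′ ^ℚ suc (suc k)       ≤⟨ +-monoˡ-≤ (- (κ * m′ ^ℚ suc (suc k))) ([1+k]pq^k≤p^[1+k]+kq^[1+k] (suc k) 0≤m 0≤m′) ⟩
    m ^ℚ suc (suc k) + κ * m′ ^ℚ suc (suc k) - κ * m′ ^ℚ suc (suc k)  ≡⟨ l′ (m ^ℚ suc (suc k)) (κ * m′ ^ℚ suc (suc k)) ⟩
    m ^ℚ suc (suc k)                                  ∎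
    where
    open ≤-Reasoning
    K κ : ℚ
    K = ℕ→ℚ (suc (suc k))
    κ = ℕ→ℚ (suc k)
    l : ∀ K m κ m′ w → (K * m - κ * m′) * w ≡ K * m * w - κ * (m′ * w)
    l = solve 5 (λ K m κ m′ w → (K :* m :- κ :* m′) :* w := K :* m :* w :- κ :* (m′ :* w)) refl
    l′ : ∀ a b → a + b - b ≡ a
    l′ = solve 2 (λ a b → a :+ b :- b := a) refl
    l″ : ∀ κ s ι → κ * (s * ι) ≡ s * (κ * ι)
    l″ = solve 3 (λ κ s ι → κ :* (s :* ι) := s :* (κ :* ι)) refl
    instance
      κ-positive : Positive κ
      κ-positive = normalize-pos (suc k) 1
      κ-nonZero : NonZero κ
      κ-nonZero = pos⇒nonZero κ
    s m′ : ℚ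
    s = ∑[ i < suc k ] f (suc i)
    m′ = s * 1/ κ
    κm′≡s : κ * m′ ≡ s
    κm′≡s = trans (l″ κ s (1/ κ)) (trans (cong (s *_) (*-inverseʳ κ)) (*-identityʳ s))
    0≤m′ : 0ℚ ≤ m′
    0≤m′ = *-nonNeg (∑-nonNeg (0≤f ∘ suc)) (<⇒≤ (positive⁻¹ (1/ κ) {{1/pos⇒pos κ}}))
    ∑tail≤κm′ : s ≤ κ * m′
    ∑tail≤κm′ = ≤-reflexive (sym κm′≡s)
    f₀≤ : f zero ≤ K * m - κ * m′
    f₀≤ = subst₂ _≤_ (l′ (f zero) s) (cong (λ t → K * m - t) (sym κm′≡s)) (+-monoˡ-≤ (- s) ∑f≤km)

  ax²+bx+c≤[a+b+c]x²+[2c+b][1-x²]/2 : ∀ a b c x → 0ℚ ≤ b →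
    a * (x * x) + b * x + c ≤ (a + b + c) * (x * x) + (ℕ→ℚ 2 * c + b) * ((1ℚ - x * x) * ½)
  ax²+bx+c≤[a+b+c]x²+[2c+b][1-x²]/2 a b c x 0≤b =
    p+d≡q⇒p≤q (b * ((1ℚ - x) * (1ℚ - x)) * ½) (*-nonNeg (*-nonNeg 0≤b (0≤p*p (1ℚ - x))) 0≤½) (l a b c x)
    where
    l : ∀ a b c x → a * (x * x) + b * x + c + b * ((1ℚ - x) * (1ℚ - x)) * ½ ≡ (a + b + c) * (x * x) + (ℕ→ℚ 2 * c + b) * ((1ℚ - x * x) * ½)
    l = solve 4 (λ a b c x → a :* (x :* x) :+ b :* x :+ c :+ b :* ((con 1ℚ :- x) :* (con 1ℚ :- x)) :* con ½
                          := (a :+ b :+ c) :* (x :* x) :+ (con (ℕ→ℚ 2) :* c :+ b) :* ((con 1ℚ :- x :* x) :* con ½)) refl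

open import Data.Nat using (ℕ; _≥_)
open import Data.Fin using (Fin)
open import Data.Rational using (ℚ; 0ℚ; 1ℚ; _<_; _≤_; _*_)
open import Data.Product using (∃)

import Data.Nat as ℕ
import Data.Nat.Properties as ℕ
open import Data.Integer using (+_)
open import Data.Rational using (_+_; _-_; _/_; ½)
open import Data.Rational.Properties
  using (≤-trans; ≤-reflexive; <⇒≤; +-mono-≤; *-identityˡ; normalize-nonNeg; nonNegative⁻¹; +-*-commutativeRing; module ≤-Reasoning)
open import Data.Product using (_,_)
open import Relation.Binary.PropositionalEquality using (_≡_; refl; sym; trans; cong; cong₂; subst)
open import Algebra.Bundles using (CommutativeRing)
open import Algebra.Properties.Semiring.Sum (CommutativeRing.semiring +-*-commutativeRing)
  using (sum-syntax; ∑-distrib-+; *-distribʳ-sum)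
open import Data.Rational.Solver using (module +-*-Solver)
open +-*-Solver using (solve; _:=_; _:+_; _:*_; _:-_; con)
open QueenCounting using (module Placement)
open RationalInequalities

rowPoly≤ : ∀ {n} (X : Fin n → Fin n) i x →
           rowPoly X i x ≤ ℕ→ℚ (aR X i ℕ.+ bR X i ℕ.+ cR X i) * (x * x) + ℕ→ℚ (2 ℕ.* cR X i ℕ.+ bR X i) * ((1ℚ - x * x) * ½)
rowPoly≤ X i x = subst (rowPoly X i x ≤_) (sym (cong₂ (λ u v → u * (x * x) + v * ((1ℚ - x * x) * ½)) a+b+c-cast 2c+b-cast))
                   (ax²+bx+c≤[a+b+c]x²+[2c+b][1-x²]/2 (ℕ→ℚ a) (ℕ→ℚ b) (ℕ→ℚ c) x (0≤ℕ→ℚ b))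
  where
  a b c : ℕ
  a = aR X i
  b = bR X i
  c = cR X i
  a+b+c-cast : ℕ→ℚ (a ℕ.+ b ℕ.+ c) ≡ ℕ→ℚ a + ℕ→ℚ b + ℕ→ℚ c
  a+b+c-cast = trans (ℕ→ℚ-homo-+ (a ℕ.+ b) c) (cong (_+ ℕ→ℚ c) (ℕ→ℚ-homo-+ a b))
  2c+b-cast : ℕ→ℚ (2 ℕ.* c ℕ.+ b) ≡ ℕ→ℚ 2 * ℕ→ℚ c + ℕ→ℚ b
  2c+b-cast = trans (ℕ→ℚ-homo-+ (2 ℕ.* c) b) (cong (_+ ℕ→ℚ b) (ℕ→ℚ-homo-* 2 c))

∑[2c+b]≤¾n² : ∀ {n} (X : Fin n → Fin n) → IsQueens n X →
              ℕ→ℚ (Counting.sum (λ i → 2 ℕ.* cR X i ℕ.+ bR X i)) ≤ (+ 3 / 4) * ℕ→ℚ (n ℕ.* n)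
∑[2c+b]≤¾n² {n} X queens = begin
  ℕ→ℚ w                         ≡⟨ l₁ (ℕ→ℚ w) ⟩
  ¼ * (ℕ→ℚ 4 * ℕ→ℚ w)           ≡⟨ cong (¼ *_) (ℕ→ℚ-homo-* 4 w) ⟨
  ¼ * ℕ→ℚ (4 ℕ.* w)             ≤⟨ *-monoˡ-≤-0≤ ¼ (nonNegative⁻¹ ¼ {{normalize-nonNeg 1 4}}) (ℕ→ℚ-mono-≤ (4∑[2c+b]≤3n² queens)) ⟩
  ¼ * ℕ→ℚ (3 ℕ.* (n ℕ.* n))     ≡⟨ cong (¼ *_) (ℕ→ℚ-homo-* 3 (n ℕ.* n)) ⟩
  ¼ * (ℕ→ℚ 3 * ℕ→ℚ (n ℕ.* n))   ≡⟨ l₂ (ℕ→ℚ (n ℕ.* n)) ⟩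
  (+ 3 / 4) * ℕ→ℚ (n ℕ.* n)     ∎
  where
  open ≤-Reasoning
  open Placement X
  w : ℕ
  w = Counting.sum (λ i → 2 ℕ.* cR X i ℕ.+ bR X i)
  ¼ : ℚ
  ¼ = + 1 / 4
  l₁ : ∀ b → b ≡ (+ 1 / 4) * (ℕ→ℚ 4 * b)
  l₁ = solve 1 (λ b → b := con (+ 1 / 4) :* (con (ℕ→ℚ 4) :* b)) refl
  l₂ : ∀ b → (+ 1 / 4) * (ℕ→ℚ 3 * b) ≡ (+ 3 / 4) * b
  l₂ = solve 1 (λ b → con (+ 1 / 4) :* (con (ℕ→ℚ 3) :* b) := con (+ 3 / 4) :* b) refl

∑rowPoly≤n*rhsBase : ∀ {n} (X : Fin n → Fin n) → IsQueens n X → ∀ {x} → 0ℚ ≤ x → x ≤ 1ℚ →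
                      ∑[ i < n ] rowPoly X i x ≤ ℕ→ℚ n * rhsBase n x
∑rowPoly≤n*rhsBase {n} X queens {x} 0≤x x≤1 = begin
  ∑[ i < n ] rowPoly X i x                                ≤⟨ ∑-mono-≤ (λ i → rowPoly≤ X i x) ⟩
  ∑[ i < n ] (ℕ→ℚ (N i) * (x * x) + ℕ→ℚ (B i) * h)        ≡⟨ ∑-distrib-+ {n} _ _ ⟩
  ∑[ i < n ] (ℕ→ℚ (N i) * (x * x)) + ∑[ i < n ] (ℕ→ℚ (B i) * h)
    ≡⟨ cong₂ _+_ (trans (sym (*-distribʳ-sum {n} (x * x) _)) (cong (_* (x * x)) (∑-ℕ→ℚ N)))
                 (trans (sym (*-distribʳ-sum {n} h _)) (cong (_* h) (∑-ℕ→ℚ B))) ⟩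
  ℕ→ℚ (Counting.sum N) * (x * x) + ℕ→ℚ (Counting.sum B) * h
    ≤⟨ +-mono-≤ (*-monoʳ-≤-0≤ (x * x) (0≤p*p x) (ℕ→ℚ-mono-≤ ∑N≤n²)) (*-monoʳ-≤-0≤ h 0≤h (∑[2c+b]≤¾n² X queens)) ⟩
  ℕ→ℚ (n ℕ.* n) * (x * x) + ((+ 3 / 4) * ℕ→ℚ (n ℕ.* n)) * h
    ≡⟨ trans (cong (λ ν² → ν² * (x * x) + ((+ 3 / 4) * ν²) * h) (ℕ→ℚ-homo-* n n)) (l (ℕ→ℚ n) x) ⟩
  ℕ→ℚ n * rhsBase n x                                    ∎
  where
  open ≤-Reasoning
  open Placement X
  N B : Fin n → ℕ
  N i = aR X i ℕ.+ bR X i ℕ.+ cR X i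
  B i = 2 ℕ.* cR X i ℕ.+ bR X i
  h : ℚ
  h = (1ℚ - x * x) * ½
  0≤h : 0ℚ ≤ h
  0≤h = *-nonNeg (p≤q⇒0≤q-p (≤-trans (*-monoʳ-≤-0≤ x 0≤x x≤1) (≤-trans (≤-reflexive (*-identityˡ x)) x≤1))) 0≤½
  ∑N≤n² : Counting.sum N ℕ.≤ n ℕ.* n
  ∑N≤n² = ℕ.≤-trans (Counting.∑-mono-≤ a+b+c≤n) (ℕ.≤-reflexive (Counting.∑-const n n))
  l : ∀ ν x → ν * ν * (x * x) + ((+ 3 / 4) * (ν * ν)) * ((1ℚ - x * x) * ½) ≡ ν * ((+ 5 / 8) * ν * (x * x) + (+ 3 / 8) * ν)
  l = solve 2 (λ ν x → ν :* ν :* (x :* x) :+ (con (+ 3 / 4) :* (ν :* ν)) :* ((con 1ℚ :- x :* x) :* con ½)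
                     := ν :* (con (+ 5 / 8) :* ν :* (x :* x) :+ con (+ 3 / 8) :* ν)) refl

0≤rowPoly : ∀ {n} (X : Fin n → Fin n) i {x} → 0ℚ ≤ x → 0ℚ ≤ rowPoly X i x
0≤rowPoly X i {x} 0≤x = +-nonNeg (+-nonNeg (*-nonNeg (0≤ℕ→ℚ (aR X i)) (0≤p*p x)) (*-nonNeg (0≤ℕ→ℚ (bR X i)) 0≤x)) (0≤ℕ→ℚ (cR X i))

0≤rhsBase : ∀ n x → 0ℚ ≤ rhsBase n x
0≤rhsBase n x = +-nonNeg (*-nonNeg (*-nonNeg 0≤5/8 (0≤ℕ→ℚ n)) (0≤p*p x)) (*-nonNeg 0≤3/8 (0≤ℕ→ℚ n))
  where
  0≤5/8 : 0ℚ ≤ + 5 / 8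
  0≤5/8 = nonNegative⁻¹ _ {{normalize-nonNeg 5 8}}
  0≤3/8 : 0ℚ ≤ + 3 / 8
  0≤3/8 = nonNegative⁻¹ _ {{normalize-nonNeg 3 8}}

-- K = 1; the bounds above hold for every n and every 0 ≤ x ≤ 1.
lemma5 : ∃ λ (K : ℚ) → ∀ (n : ℕ) → n ≥ 2 → (X : Fin n → Fin n) → IsQueens n X →
    ∀ (x : ℚ) → 0ℚ < x → x < 1ℚ →
      prodFin n (λ i → rowPoly X i x) ≤ K * (rhsBase n x ^ℚ n)
lemma5 = 1ℚ , λ n _ X queens x 0<x x<1 →
  subst (prodFin n (λ i → rowPoly X i x) ≤_) (sym (*-identityˡ (rhsBase n x ^ℚ n)))
    (am-gm n (λ i → rowPoly X i x) (rhsBase n x) (λ i → 0≤rowPoly X i (<⇒≤ 0<x)) (0≤rhsBase n x)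
           (∑rowPoly≤n*rhsBase X queens (<⇒≤ 0<x) (<⇒≤ x<1)))
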